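{- Let $K$ be a $2$-complex and $v$ a vertex of $K$. Suppose $\mathrm{lk}_K(v)$ is a star other than the single edge, with centre $w$, and that $\mathrm{lk}_K(w)$ is also a star. Then there is an automorphism of $K$ which swaps $v$ and $w$ and fixes all other vertices.
   Context: A $2$-complex is a finite simplicial complex of dimension at most $2$. For a vertex $v$ of $K$, the link $\mathrm{lk}_K(v)$ is the graph consisting of faces $\tau\in K$ with $v\notin\tau$ and $\tau\cup\{v\}\in K$. A star is a tree of diameter at most two, i.e. $K_{1,n}$ for some $n\ge 0$ ($K_{1,0}$ is a single vertex). Every star other than the single edge $K_{1,1}$ has a distinguished centre: the unique vertex of degree different from one (for the one-vertex star, that vertex). -}

module Defs where

open import Data.Nat using (ℕ; _≤_)
open import Data.Bool using (Bool; true; false; T; _∧_; not)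
open import Data.Fin using (Fin; _≟_)
open import Data.Fin.Subset using (Subset; ⁅_⁆; _∪_; _⊆_; ∣_∣; _∈_; _∉_)
open import Data.Fin.Permutation using (Permutation′; _⟨$⟩ʳ_; _⟨$⟩ˡ_)
open import Data.Vec using (tabulate; lookup)
open import Data.Product using (Σ; ∃; ∃-syntax; _×_)
open import Data.Sum using (_⊎_)
open import Relation.Binary.PropositionalEquality using (_≡_)
open import Relation.Nullary using (¬_)
open import Relation.Nullary.Decidable using (⌊_⌋)

FaceSet : ℕ → Set
FaceSet n = Subset n → Bool

record Complex2 (n : ℕ) : Set where
  field
    face        : FaceSet n
    down-closed : ∀ σ τ → τ ⊆ σ → T (face σ) → T (face τ)
    dim≤2       : ∀ σ → T (face σ) → ∣ σ ∣ ≤ 3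
open Complex2 public

module _ {n : ℕ} (F : FaceSet n) where
  IsVertex : Fin n → Set
  IsVertex x = T (F ⁅ x ⁆)

  edgeB : Fin n → Fin n → Bool
  edgeB x y = not ⌊ x ≟ y ⌋ ∧ F (⁅ x ⁆ ∪ ⁅ y ⁆)

  IsEdge : Fin n → Fin n → Set
  IsEdge x y = T (edgeB x y)

  degree : Fin n → ℕ
  degree x = ∣ tabulate (edgeB x) ∣

  StarAt : Fin n → Set
  StarAt c = IsVertex c
           × (∀ x → IsVertex x → ¬ (x ≡ c) → IsEdge c x)
           × (∀ x y → IsEdge x y → (x ≡ c) ⊎ (y ≡ c))

  -- a star: a tree of diameter ≤ 2, i.e. K_{1,m} for some m ≥ 0
  IsStar : Set
  IsStar = ∃[ c ] StarAt c

  IsSingleEdge : Set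
  IsSingleEdge = ∃[ a ] ∃[ b ] (IsEdge a b × (∀ x → IsVertex x → (x ≡ a) ⊎ (x ≡ b)))

  -- w is the centre of a star other than K_{1,1}: a vertex of degree ≠ 1
  IsCentre : Fin n → Set
  IsCentre w = IsVertex w × ¬ (degree w ≡ 1)

link : ∀ {n} → Complex2 n → Fin n → FaceSet n
link K v τ = not (lookup τ v) ∧ face K (τ ∪ ⁅ v ⁆)

image : ∀ {n} → Permutation′ n → Subset n → Subset n
image π σ = tabulate (λ y → lookup σ (π ⟨$⟩ˡ y))

-- π (a permutation of Fin n, hence restricting to a bijection of the
-- vertex set of K) is an automorphism of K: σ ∈ K iff π(σ) ∈ K
IsAutomorphism : ∀ {n} → Complex2 n → Permutation′ n → Set
IsAutomorphism K π = ∀ σ → face K (image π σ) ≡ face K σ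

-- A star has at most one vertex of degree ≠ 1, so the centre of lk v is w.
-- Symmetrically the centre of lk w is v: were it some c ≠ v, every edge at w
-- in lk v would span a triangle with v, hence be an edge at v in lk w, hence
-- end in c, and w would have degree one in lk v.
-- If lk a is a star centred at b and σ is a face containing a, then σ ∪ {b}
-- is again a face: the rest of σ avoids b, so it is empty or a single vertex
-- of lk a, which is joined to b. The image of σ under the swap (v w) lies in
-- σ, σ ∪ {v} or σ ∪ {w}, so the swap maps faces to faces, and being an
-- involution it is an automorphism.
module Submission where

open import Defs
open import Data.Nat using (ℕ)
open import Data.Bool using (true; false; T; not)
open import Data.Bool.Properties using (T-≡; T-∧; ⇔→≡)
open import Data.Empty using (⊥-elim)
open import Data.Fin using (Fin; _≟_)
open import Data.Fin.Permutation using (Permutation′; _⟨$⟩ʳ_; _⟨$⟩ˡ_; transpose)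
import Data.Fin.Permutation.Components as PC
open import Data.Fin.Properties using (any?)
open import Data.Fin.Subset using (Subset; ⁅_⁆; _∪_; _⊆_; ∣_∣; _∈_; _∉_)
open import Data.Fin.Subset.Properties
  using (_∈?_; x∈⁅x⁆; x∈⁅y⁆⇒x≡y; x≢y⇒x∉⁅y⁆; x∉⁅y⁆⇒x≢y; ∣⁅x⁆∣≡1; ∪-comm; ⊆-refl; p⊆p∪q; q⊆p∪q; x∈p∪q⁻)
open import Data.Product using (∃-syntax; _×_; _,_; proj₁; proj₂)
open import Data.Sum using ([_,_]′)
open import Data.Unit using (tt)
open import Data.Vec using (tabulate; lookup)
open import Data.Vec.Properties using (lookup∘tabulate; tabulate∘lookup; tabulate-cong; []=⇒lookup; lookup⇒[]=)
open import Function using (_∘_; id)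
open import Function.Bundles using (_⇔_; mk⇔; Equivalence)
import Function.Properties.Equivalence as ⇔
open import Relation.Binary.PropositionalEquality using (_≡_; _≢_; refl; sym; trans; subst; cong)
open import Relation.Nullary using (¬_; yes; no)
open import Relation.Nullary.Decidable using (_×-dec_; ¬?; toWitnessFalse; fromWitnessFalse)

open Equivalence using (to; from)

private variable
  n : ℕ
  a b c w x y z : Fin n
  p σ τ : Subset n

T-injective : ∀ {x y} → T x ⇔ T y → x ≡ y
T-injective x⇔y = ⇔→≡ (⇔.trans (⇔.sym T-≡) (⇔.trans x⇔y T-≡))

∈⇔T-lookup : x ∈ p ⇔ T (lookup p x)
∈⇔T-lookup {x = x} {p} = mk⇔ (from T-≡ ∘ []=⇒lookup) (lookup⇒[]= x p ∘ to T-≡)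

∉⇒T-not-lookup : x ∉ p → T (not (lookup p x))
∉⇒T-not-lookup {x = x} {p} x∉p with lookup p x in eq
... | true  = x∉p (lookup⇒[]= x p eq)
... | false = tt

T-not-lookup⇒∉ : T (not (lookup p x)) → x ∉ p
T-not-lookup⇒∉ t x∈p = subst (T ∘ not) ([]=⇒lookup x∈p) t

⟪_,_⟫ : Fin n → Fin n → Subset n
⟪ x , y ⟫ = ⁅ x ⁆ ∪ ⁅ y ⁆

△ : Fin n → Fin n → Fin n → Subset n
△ x y z = ⟪ x , y ⟫ ∪ ⁅ z ⁆

x∈⟪x,y⟫ : x ∈ ⟪ x , y ⟫
x∈⟪x,y⟫ {x = x} = p⊆p∪q _ (x∈⁅x⁆ x)

y∈⟪x,y⟫ : y ∈ ⟪ x , y ⟫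
y∈⟪x,y⟫ {y = y} = q⊆p∪q _ _ (x∈⁅x⁆ y)

x∈△ : x ∈ △ x y z
x∈△ = p⊆p∪q _ x∈⟪x,y⟫

y∈△ : y ∈ △ x y z
y∈△ = p⊆p∪q _ y∈⟪x,y⟫

z∈△ : z ∈ △ x y z
z∈△ {z = z} = q⊆p∪q _ _ (x∈⁅x⁆ z)

∪-⊆ : σ ⊆ p → τ ⊆ p → σ ∪ τ ⊆ p
∪-⊆ {σ = σ} {τ = τ} σ⊆p τ⊆p = [ σ⊆p , τ⊆p ]′ ∘ x∈p∪q⁻ σ τ

⁅⁆-⊆ : x ∈ p → ⁅ x ⁆ ⊆ p
⁅⁆-⊆ {x = x} {p} x∈p y∈⁅x⁆ = subst (_∈ p) (sym (x∈⁅y⁆⇒x≡y x y∈⁅x⁆)) x∈p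

⟪,⟫-⊆ : x ∈ p → y ∈ p → ⟪ x , y ⟫ ⊆ p
⟪,⟫-⊆ x∈p y∈p = ∪-⊆ (⁅⁆-⊆ x∈p) (⁅⁆-⊆ y∈p)

△-⊆ : x ∈ p → y ∈ p → z ∈ p → △ x y z ⊆ p
△-⊆ x∈p y∈p z∈p = ∪-⊆ (⟪,⟫-⊆ x∈p y∈p) (⁅⁆-⊆ z∈p)

∈∉⇒≢ : x ∈ p → y ∉ p → x ≢ y
∈∉⇒≢ x∈p y∉p refl = y∉p x∈p

∉⟪,⟫ : z ≢ x → z ≢ y → z ∉ ⟪ x , y ⟫
∉⟪,⟫ {x = x} {y = y} z≢x z≢y =
  [ x≢y⇒x∉⁅y⁆ z≢x , x≢y⇒x∉⁅y⁆ z≢y ]′ ∘ x∈p∪q⁻ ⁅ x ⁆ ⁅ y ⁆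

transpose-matchˡ : (x y : Fin n) → PC.transpose x y x ≡ y
transpose-matchˡ x y with x ≟ x
... | yes _   = refl
... | no x≢x  = ⊥-elim (x≢x refl)

transpose-matchʳ : (x y : Fin n) → PC.transpose x y y ≡ x
transpose-matchʳ x y with y ≟ x
... | yes y≡x = y≡x
... | no _ with y ≟ y
...   | yes _  = refl
...   | no y≢y = ⊥-elim (y≢y refl)

transpose-fixes : z ≢ x → z ≢ y → PC.transpose x y z ≡ z
transpose-fixes {z = z} {x} {y} z≢x z≢y with z ≟ x
... | yes z≡x = ⊥-elim (z≢x z≡x)
... | no _ with z ≟ y
...   | yes z≡y = ⊥-elim (z≢y z≡y)
...   | no _    = refl

∈-image⁻ : (π : Permutation′ n) → y ∈ image π σ → π ⟨$⟩ˡ y ∈ σ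
∈-image⁻ {y = y} {σ} π y∈πσ =
  lookup⇒[]= _ σ (trans (sym (lookup∘tabulate _ y)) ([]=⇒lookup y∈πσ))

∈-image⁺ : (π : Permutation′ n) → π ⟨$⟩ˡ y ∈ σ → y ∈ image π σ
∈-image⁺ {y = y} {σ} π πy∈σ =
  lookup⇒[]= y _ (trans (lookup∘tabulate _ y) ([]=⇒lookup πy∈σ))

image-transpose-⊆ : (b ∈ σ → a ∈ τ) → (a ∈ σ → b ∈ τ) → σ ⊆ τ → image (transpose a b) σ ⊆ τ
image-transpose-⊆ {b = b} {σ} {a} b→a a→b σ⊆τ {y} y∈σ′ with ∈-image⁻ (transpose a b) y∈σ′ | y ≟ a | y ≟ b
... | τy∈σ | yes refl | _        = b→a (subst (_∈ σ) (transpose-matchʳ b a) τy∈σ)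
... | τy∈σ | no _     | yes refl = a→b (subst (_∈ σ) (transpose-matchˡ b a) τy∈σ)
... | τy∈σ | no y≢a   | no y≢b   = σ⊆τ (subst (_∈ σ) (transpose-fixes y≢b y≢a) τy∈σ)

module _ {n : ℕ} (F : FaceSet n) where

  edge⁺ : x ≢ y → T (F ⟪ x , y ⟫) → IsEdge F x y
  edge⁺ x≢y f = from T-∧ (fromWitnessFalse x≢y , f)

  edge⁻ : IsEdge F x y → x ≢ y × T (F ⟪ x , y ⟫)
  edge⁻ e = let (x≢y , f) = to T-∧ e in toWitnessFalse x≢y , f

  IsEdge-sym : IsEdge F x y → IsEdge F y x
  IsEdge-sym {x = x} {y} e =
    let (x≢y , f) = edge⁻ e in edge⁺ (x≢y ∘ sym) (subst (T ∘ F) (∪-comm ⁅ x ⁆ ⁅ y ⁆) f)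

  degree≡1 : IsEdge F w c → (∀ y → IsEdge F w y → y ≡ c) → degree F w ≡ 1
  degree≡1 {w = w} {c} e only = trans (cong ∣_∣ neighbours≡⁅c⁆) (∣⁅x⁆∣≡1 c)
    where
    neighbours≡⁅c⁆ : tabulate (edgeB F w) ≡ ⁅ c ⁆
    neighbours≡⁅c⁆ = trans (tabulate-cong (λ y → T-injective (mk⇔
        (λ e′ → to ∈⇔T-lookup (subst (_∈ ⁅ c ⁆) (sym (only y e′)) (x∈⁅x⁆ c)))
        (λ t → subst (IsEdge F w) (sym (x∈⁅y⁆⇒x≡y c (from ∈⇔T-lookup t))) e))))
      (tabulate∘lookup ⁅ c ⁆)

  centre-unique : StarAt F c → IsCentre F w → w ≡ c
  centre-unique {c = c} {w = w} (_ , adjacent , covered) (w∈F , degree≢1) with w ≟ c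
  ... | yes w≡c = w≡c
  ... | no w≢c = ⊥-elim (degree≢1 (degree≡1 (IsEdge-sym (adjacent w w∈F w≢c)) only-c))
    where
    only-c : ∀ y → IsEdge F w y → y ≡ c
    only-c y e = [ ⊥-elim ∘ w≢c , id ]′ (covered w y e)

module _ {n : ℕ} (K : Complex2 n) where

  face-⊆ : σ ⊆ τ → T (face K τ) → T (face K σ)
  face-⊆ {σ} {τ} = down-closed K τ σ

  link⁺ : a ∉ τ → T (face K (τ ∪ ⁅ a ⁆)) → T (link K a τ)
  link⁺ a∉τ f = from T-∧ (∉⇒T-not-lookup a∉τ , f)

  link⁻ : T (link K a τ) → a ∉ τ × T (face K (τ ∪ ⁅ a ⁆))
  link⁻ t = let (a∉τ , f) = to T-∧ t in T-not-lookup⇒∉ a∉τ , f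

  link-vertex⁺ : a ≢ x → T (face K ⟪ x , a ⟫) → IsVertex (link K a) x
  link-vertex⁺ a≢x = link⁺ (x≢y⇒x∉⁅y⁆ a≢x)

  link-vertex⁻ : IsVertex (link K a) x → a ≢ x × T (face K ⟪ x , a ⟫)
  link-vertex⁻ t = let (a∉⁅x⁆ , f) = link⁻ t in x∉⁅y⁆⇒x≢y a∉⁅x⁆ , f

  link-edge⁺ : x ≢ y → a ≢ x → a ≢ y → T (face K (△ x y a)) → IsEdge (link K a) x y
  link-edge⁺ x≢y a≢x a≢y f = edge⁺ (link K _) x≢y (link⁺ (∉⟪,⟫ a≢x a≢y) f)

  link-edge⁻ : IsEdge (link K a) x y → x ≢ y × a ≢ x × a ≢ y × T (face K (△ x y a))
  link-edge⁻ {a} e =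
    let (x≢y , t)   = edge⁻ (link K a) e
        (a∉xy , f)  = link⁻ t
    in x≢y , (λ a≡x → a∉xy (subst (_∈ _) (sym a≡x) x∈⟪x,y⟫))
           , (λ a≡y → a∉xy (subst (_∈ _) (sym a≡y) y∈⟪x,y⟫)) , f

  centre-of-link-of-centre : IsCentre (link K a) b → StarAt (link K b) c → c ≡ a
  centre-of-link-of-centre {a} {b} {c} (b∈lk-a , degree≢1) (_ , adjacent , covered) with a ≟ c
  ... | yes a≡c = sym a≡c
  ... | no a≢c = ⊥-elim (degree≢1 (degree≡1 (link K a) {w = b} edge-bc only-c))
    where
    a≢b : a ≢ b
    a≢b = proj₁ (link-vertex⁻ b∈lk-a)

    a∈lk-b : IsVertex (link K b) a
    a∈lk-b = link-vertex⁺ (a≢b ∘ sym) (face-⊆ (⟪,⟫-⊆ y∈⟪x,y⟫ x∈⟪x,y⟫) (proj₂ (link-vertex⁻ b∈lk-a)))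

    edge-bc : IsEdge (link K a) b c
    edge-bc with link-edge⁻ (adjacent a a∈lk-b a≢c)
    ... | _ , b≢c , _ , f = link-edge⁺ b≢c a≢b a≢c (face-⊆ (△-⊆ z∈△ x∈△ y∈△) f)

    only-c : ∀ y → IsEdge (link K a) b y → y ≡ c
    only-c y e with link-edge⁻ e
    ... | b≢y , _ , a≢y , f =
      [ ⊥-elim ∘ a≢c , id ]′ (covered a y (link-edge⁺ a≢y (a≢b ∘ sym) b≢y
        (face-⊆ (△-⊆ z∈△ y∈△ x∈△) f)))

  face-∪-centre : StarAt (link K a) b → a ∈ σ → T (face K σ) → T (face K (σ ∪ ⁅ b ⁆))
  face-∪-centre {a} {b} {σ} (b∈lk-a , adjacent , covered) a∈σ fσ with b ∈? σ
  ... | yes b∈σ = face-⊆ (∪-⊆ ⊆-refl (⁅⁆-⊆ b∈σ)) fσ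
  ... | no b∉σ with any? (λ x → (x ∈? σ) ×-dec ¬? (x ≟ a))
  ...   | no none = face-⊆ (∪-⊆ σ⊆ (⁅⁆-⊆ x∈⟪x,y⟫)) (proj₂ (link-vertex⁻ b∈lk-a))
    where
    σ⊆ : σ ⊆ ⟪ b , a ⟫
    σ⊆ {y} y∈σ with y ≟ a
    ... | yes refl = y∈⟪x,y⟫
    ... | no y≢a   = ⊥-elim (none (y , y∈σ , y≢a))
  ...   | yes (x , x∈σ , x≢a) =
    face-⊆ (∪-⊆ σ⊆ (⁅⁆-⊆ x∈△)) (proj₂ (proj₂ (proj₂ (link-edge⁻ (adjacent x x∈lk-a x≢b)))))
    where
    x∈lk-a : IsVertex (link K a) x
    x∈lk-a = link-vertex⁺ (x≢a ∘ sym) (face-⊆ (⟪,⟫-⊆ x∈σ a∈σ) fσ)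

    x≢b : x ≢ b
    x≢b = ∈∉⇒≢ x∈σ b∉σ

    -- An edge of lk a inside σ would have to contain the centre b ∉ σ.
    only-x : y ∈ σ → y ≢ a → y ≡ x
    only-x {y} y∈σ y≢a with y ≟ x
    ... | yes y≡x = y≡x
    ... | no y≢x  = ⊥-elim ([ x≢b , ∈∉⇒≢ y∈σ b∉σ ]′ (covered x y
        (link-edge⁺ (y≢x ∘ sym) (x≢a ∘ sym) (y≢a ∘ sym) (face-⊆ (△-⊆ x∈σ y∈σ a∈σ) fσ))))

    σ⊆ : σ ⊆ △ b x a
    σ⊆ {y} y∈σ with y ≟ a
    ... | yes refl = z∈△
    ... | no y≢a   = subst (_∈ △ b x a) (sym (only-x y∈σ y≢a)) y∈△

  face-image-transpose : StarAt (link K a) b → StarAt (link K b) a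
                       → T (face K σ) → T (face K (image (transpose a b) σ))
  face-image-transpose {a} {b} {σ} star-a star-b fσ with a ∈? σ | b ∈? σ
  ... | yes a∈σ | _ =
    face-⊆ (image-transpose-⊆ (λ _ → p⊆p∪q _ a∈σ) (λ _ → q⊆p∪q σ _ (x∈⁅x⁆ b)) (p⊆p∪q _))
           (face-∪-centre star-a a∈σ fσ)
  ... | no a∉σ  | yes b∈σ =
    face-⊆ (image-transpose-⊆ (λ _ → q⊆p∪q σ _ (x∈⁅x⁆ a)) (⊥-elim ∘ a∉σ) (p⊆p∪q _))
           (face-∪-centre star-b b∈σ fσ)
  ... | no a∉σ  | no b∉σ  = face-⊆ (image-transpose-⊆ (⊥-elim ∘ b∉σ) (⊥-elim ∘ a∉σ) ⊆-refl) fσ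

  transpose-automorphism : StarAt (link K a) b → StarAt (link K b) a → IsAutomorphism K (transpose a b)
  transpose-automorphism {a} {b} star-a star-b σ = T-injective (mk⇔
    (face-⊆ σ⊆ ∘ face-image-transpose star-b star-a)
    (face-image-transpose star-a star-b))
    where
    σ⊆ : σ ⊆ image (transpose b a) (image (transpose a b) σ)
    σ⊆ y∈σ = ∈-image⁺ (transpose b a) (∈-image⁺ (transpose a b)
               (subst (_∈ σ) (sym (PC.transpose-inverse b a)) y∈σ))

lemma3p1 : ∀ {n} (K : Complex2 n) (v w : Fin n)
    → IsVertex (face K) v
    → IsStar (link K v)
    → ¬ IsSingleEdge (link K v)
    → IsCentre (link K v) w
    → IsStar (link K w)
    → ∃[ π ] (IsAutomorphism K π
    × (π ⟨$⟩ʳ v ≡ w)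
    × (π ⟨$⟩ʳ w ≡ v)
    × (∀ x → IsVertex (face K) x → ¬ (x ≡ v) → ¬ (x ≡ w) → π ⟨$⟩ʳ x ≡ x))
-- The hypotheses that v is a vertex and lk v is not a single edge follow from IsCentre.
lemma3p1 K v w _ (_ , star-v) _ centre (_ , star-w) =
  transpose v w , transpose-automorphism K star-v-at-w star-w-at-v ,
  transpose-matchˡ v w , transpose-matchʳ v w , λ x _ x≢v x≢w → transpose-fixes x≢v x≢w
  where
  star-v-at-w : StarAt (link K v) w
  star-v-at-w = subst (StarAt (link K v)) (sym (centre-unique (link K v) star-v centre)) star-v

  star-w-at-v : StarAt (link K w) v
  star-w-at-v = subst (StarAt (link K w)) (centre-of-link-of-centre K centre star-w) star-w
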